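{- Let $D$ be a finite connected digraph with $\chi(D)=5$, not isomorphic to $T_5$, in which every vertex has out-degree at least $2$, such that $D$ contains no copy of $p_4$ and the underlying graph of $D$ contains no $K_5$. Let $D'$ be a $5$-critical subdigraph of $D$ and let $D^o$ be the set of vertices whose out-degree in $D'$ is at least $3$. Then $D^o$ is an independent (stable) set of $D$.
   Context: A digraph has no loops and, for any two vertices $x,y$, at most one of the arcs $(x,y),(y,x)$; $\chi$ is the chromatic number of the underlying (unoriented) graph. $T_5$ is the $5$-vertex tournament in which every vertex has in- and out-degree $2$. $p_4$ is the digraph with vertices $x,y,z,v,w$ and arcs $y\to x$, $y\to z$, $v\to z$, $v\to w$; a copy of $H$ in $D$ is the image of an injective arc-preserving map $V(H)\to V(D)$. A subdigraph $D'$ is $5$-critical if $\chi(D')=5$ and $\chi(D'-u)<5$ for every vertex $u$ of $D'$. -}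

module Defs where

open import Data.Nat using (ℕ; zero; suc; _+_; _≤_)
open import Data.Fin using (Fin; zero; suc)
open import Data.Bool using (Bool; true; false; _∨_; if_then_else_)
open import Data.Product using (Σ; _×_; _,_; ∃)
open import Data.Sum using (_⊎_)
open import Relation.Binary.PropositionalEquality using (_≡_; _≢_)
open import Relation.Nullary using (¬_)
open import Function.Bundles using (_↔_; Inverse)
open import Function.Definitions using (Injective)

record Digraph : Set where
  field
    n        : ℕ
    arc      : Fin n → Fin n → Bool
    loopless : ∀ x → arc x x ≡ false
    oriented : ∀ x y → arc x y ≡ true → arc y x ≡ false
open Digraph public

V : Digraph → Set
V D = Fin (n D)

Adj : (D : Digraph) → V D → V D → Set
Adj D x y = (arc D x y ∨ arc D y x) ≡ true

count : ∀ {m} → (Fin m → Bool) → ℕ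
count {zero}  p = 0
count {suc m} p = (if p zero then 1 else 0) + count (λ i → p (suc i))

outdeg : (D : Digraph) → V D → ℕ
outdeg D x = count (arc D x)

data Reach (D : Digraph) (x : V D) : V D → Set where
  here : Reach D x x
  step : ∀ {y z} → Reach D x y → Adj D y z → Reach D x z

Connected : Digraph → Set
Connected D = ∀ x y → Reach D x y

Colourable : Digraph → ℕ → Set
Colourable D k = Σ (V D → Fin k) λ c → ∀ x y → arc D x y ≡ true → c x ≢ c y

ChromaticNumber : Digraph → ℕ → Set
ChromaticNumber D k = Colourable D k × (∀ j → j Data.Nat.< k → ¬ Colourable D j)
  where import Data.Nat

Iso : Digraph → Digraph → Set
Iso D E = Σ (V D ↔ V E) λ f →
  ∀ x y → arc D x y ≡ arc E (Inverse.to f x) (Inverse.to f y)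

-- T5: vertices Z/5, arcs i → i+1, i → i+2
t5arc : Fin 5 → Fin 5 → Bool
t5arc zero zero = false
t5arc zero (suc zero) = true
t5arc zero (suc (suc zero)) = true
t5arc zero (suc (suc (suc zero))) = false
t5arc zero (suc (suc (suc (suc zero)))) = false
t5arc (suc zero) zero = false
t5arc (suc zero) (suc zero) = false
t5arc (suc zero) (suc (suc zero)) = true
t5arc (suc zero) (suc (suc (suc zero))) = true
t5arc (suc zero) (suc (suc (suc (suc zero)))) = false
t5arc (suc (suc zero)) zero = false
t5arc (suc (suc zero)) (suc zero) = false
t5arc (suc (suc zero)) (suc (suc zero)) = false
t5arc (suc (suc zero)) (suc (suc (suc zero))) = true
t5arc (suc (suc zero)) (suc (suc (suc (suc zero)))) = true
t5arc (suc (suc (suc zero))) zero = true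
t5arc (suc (suc (suc zero))) (suc zero) = false
t5arc (suc (suc (suc zero))) (suc (suc zero)) = false
t5arc (suc (suc (suc zero))) (suc (suc (suc zero))) = false
t5arc (suc (suc (suc zero))) (suc (suc (suc (suc zero)))) = true
t5arc (suc (suc (suc (suc zero)))) zero = true
t5arc (suc (suc (suc (suc zero)))) (suc zero) = true
t5arc (suc (suc (suc (suc zero)))) (suc (suc zero)) = false
t5arc (suc (suc (suc (suc zero)))) (suc (suc (suc zero))) = false
t5arc (suc (suc (suc (suc zero)))) (suc (suc (suc (suc zero)))) = false

T5 : Digraph
T5 = record { n = 5 ; arc = t5arc ; loopless = ll ; oriented = or }
  where
  ll : ∀ x → t5arc x x ≡ false
  ll zero = _≡_.refl
  ll (suc zero) = _≡_.refl
  ll (suc (suc zero)) = _≡_.refl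
  ll (suc (suc (suc zero))) = _≡_.refl
  ll (suc (suc (suc (suc zero)))) = _≡_.refl
  or : ∀ x y → t5arc x y ≡ true → t5arc y x ≡ false
  or zero zero ()
  or zero (suc (zero)) _ = _≡_.refl
  or zero (suc (suc (zero))) _ = _≡_.refl
  or zero (suc (suc (suc (zero)))) ()
  or zero (suc (suc (suc (suc (zero))))) ()
  or (suc (zero)) zero ()
  or (suc (zero)) (suc (zero)) ()
  or (suc (zero)) (suc (suc (zero))) _ = _≡_.refl
  or (suc (zero)) (suc (suc (suc (zero)))) _ = _≡_.refl
  or (suc (zero)) (suc (suc (suc (suc (zero))))) ()
  or (suc (suc (zero))) zero ()
  or (suc (suc (zero))) (suc (zero)) ()
  or (suc (suc (zero))) (suc (suc (zero))) ()
  or (suc (suc (zero))) (suc (suc (suc (zero)))) _ = _≡_.refl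
  or (suc (suc (zero))) (suc (suc (suc (suc (zero))))) _ = _≡_.refl
  or (suc (suc (suc (zero)))) zero _ = _≡_.refl
  or (suc (suc (suc (zero)))) (suc (zero)) ()
  or (suc (suc (suc (zero)))) (suc (suc (zero))) ()
  or (suc (suc (suc (zero)))) (suc (suc (suc (zero)))) ()
  or (suc (suc (suc (zero)))) (suc (suc (suc (suc (zero))))) _ = _≡_.refl
  or (suc (suc (suc (suc (zero))))) zero _ = _≡_.refl
  or (suc (suc (suc (suc (zero))))) (suc (zero)) _ = _≡_.refl
  or (suc (suc (suc (suc (zero))))) (suc (suc (zero))) ()
  or (suc (suc (suc (suc (zero))))) (suc (suc (suc (zero)))) ()
  or (suc (suc (suc (suc (zero))))) (suc (suc (suc (suc (zero))))) ()

HasP4 : Digraph → Set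
HasP4 D = Σ (Fin 5 → V D) λ f → Injective _≡_ _≡_ f ×
  (arc D (f y) (f x) ≡ true × arc D (f y) (f z) ≡ true ×
   arc D (f v) (f z) ≡ true × arc D (f v) (f w) ≡ true)
  where
  x y z v w : Fin 5
  x = zero
  y = suc zero
  z = suc (suc zero)
  v = suc (suc (suc zero))
  w = suc (suc (suc (suc zero)))

HasK5 : Digraph → Set
HasK5 D = Σ (Fin 5 → V D) λ f → Injective _≡_ _≡_ f ×
  (∀ i j → i ≢ j → Adj D (f i) (f j))

record Sub (D : Digraph) : Set where
  field
    vs    : V D → Bool
    as    : V D → V D → Bool
    as⊆   : ∀ x y → as x y ≡ true → arc D x y ≡ true
    as-vs : ∀ x y → as x y ≡ true → (vs x ≡ true × vs y ≡ true)
open Sub public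

-- proper k-colouring of the underlying graph of the subdigraph S,
-- with vertex u deleted if given (colours of vertices outside are irrelevant)
SubColourable : ∀ {D} → Sub D → ℕ → Set
SubColourable {D} S k = Σ (V D → Fin k) λ c → ∀ x y → as S x y ≡ true → c x ≢ c y

SubColourableMinus : ∀ {D} → Sub D → V D → ℕ → Set
SubColourableMinus {D} S u k = Σ (V D → Fin k) λ c →
  ∀ x y → as S x y ≡ true → x ≢ u → y ≢ u → c x ≢ c y

SubChromatic : ∀ {D} → Sub D → ℕ → Set
SubChromatic S k = SubColourable S k × (∀ j → j Data.Nat.< k → ¬ SubColourable S j)
  where import Data.Nat

Critical5 : ∀ {D} → Sub D → Set
Critical5 {D} S = SubChromatic S 5 × (∀ u → vs S u ≡ true → SubColourableMinus S u 4)

subOutdeg : ∀ {D} → Sub D → V D → ℕ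
subOutdeg S x = count (as S x)

InDo : ∀ {D} → Sub D → V D → Set
InDo S x = vs S x ≡ true × 3 ≤ subOutdeg S x

Independent : (D : Digraph) → (V D → Set) → Set
Independent D P = ∀ x y → P x → P y → ¬ Adj D x y

-- Call a vertex heavy if its out-degree in D is at least 3. As D has no p4 and all
-- out-degrees are at least 2, two vertices with a common out-neighbour have almost the
-- same out-neighbourhood. A case analysis on this shows: if a → b is an arc between
-- heavy vertices and b → z, then b is the only in-neighbour of z in D' (a rival u would
-- have out-degree at most 2, so by criticality a further in-neighbour in D', and the
-- out-neighbourhood of b leaves no room for it). Criticality forces degree at least 4 in
-- D', so z then has out-degree at least 3 in D'. Thus the vertices of D' of out-degree
-- at least 3 in D' having a heavy in-neighbour form a set closed under the arcs of D',
-- each member sending at least 3 arcs into it and receiving only one from it; double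
-- counting shows that such a finite set is empty. An arc inside Dᵒ would put its head
-- into this set.
module Submission where

open import Data.Bool using (Bool; true; false; _∧_; _∨_; if_then_else_)
import Data.Bool as Bool
open import Data.Bool.Properties using (T-≡; ∨-zeroʳ)
open import Data.Empty using (⊥; ⊥-elim)
open import Data.Fin using (Fin; zero; suc)
open import Data.Fin.Patterns using (0F; 1F; 2F; 3F; 4F)
open import Data.Fin.Properties using (_≟_; any?; 0≢1+n; suc-injective)
open import Data.List using (List; []; _∷_; length)
open import Data.List.Membership.Propositional using (_∈_; _∉_)
open import Data.List.Relation.Unary.Any using (here; there)
open import Data.Nat using (ℕ; zero; suc; _+_; _≤_; _<_; z≤n; s≤s; _≤?_)
open import Data.Nat.Properties
  using ( ≤-reflexive; ≤-trans; <-irrefl; <-≤-trans; ≤-<-trans; ≤-pred; ≮⇒≥; n≤1+n; n<1+n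
        ; m≤n⇒m≤1+n; m<m+n; +-suc; +-mono-≤; +-monoʳ-≤; +-cancelʳ-≤; module ≤-Reasoning
        ; +-0-commutativeMonoid )
open import Algebra.Properties.CommutativeMonoid.Sum +-0-commutativeMonoid
  using (sum; sum-cong-≗; ∑-comm; ∑-distrib-+)
open import Data.Product using (∃; _×_; _,_; proj₁; proj₂; map)
open import Data.Vec.Functional using (updateAt)
open import Data.Vec.Functional.Properties using (updateAt-updates; updateAt-minimal)
open import Function using (_∘_; id; const)
open import Function.Bundles using (Equivalence)
open import Function.Definitions using (Injective)
open import Relation.Binary.PropositionalEquality
  using (_≡_; _≢_; refl; sym; trans; cong; cong₂; subst; module ≡-Reasoning)
open import Relation.Nullary using (¬_; Dec; yes; no; does; T?; _×-dec_)
open import Relation.Nullary.Decidable using (dec-true; dec-false)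
open import Relation.Unary using (Decidable)

open import Defs

private
  variable
    m k : ℕ
    p q : Fin m → Bool

does⇒ : ∀ {A : Set} (a? : Dec A) → does a? ≡ true → A
does⇒ (yes a) _ = a

∧-true : ∀ a {b} → a ∧ b ≡ true → a ≡ true × b ≡ true
∧-true true b≡true = refl , b≡true

does⇒¬ : ∀ {A : Set} (a? : Dec A) → does a? ≡ false → ¬ A
does⇒¬ (no ¬a) _ = ¬a

count-false : count {m} (λ _ → false) ≡ 0
count-false {zero}  = refl
count-false {suc m} = count-false {m}

count-true : count {m} (λ _ → true) ≡ m
count-true {zero}  = refl
count-true {suc m} = cong suc (count-true {m})

count-pos : ∀ i → p i ≡ true → 0 < count p
count-pos {p = p} zero    pᵢ rewrite pᵢ = s≤s z≤n
count-pos {p = p} (suc i) pᵢ with p zero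
... | true  = s≤s z≤n
... | false = count-pos i pᵢ

count-mono : (∀ i → p i ≡ true → q i ≡ true) → count p ≤ count q
count-mono {zero}          p⊆q = z≤n
count-mono {suc m} {p} {q} p⊆q with p zero in p₀ | q zero in q₀
... | true  | true  = s≤s (count-mono (p⊆q ∘ suc))
... | false | true  = m≤n⇒m≤1+n (count-mono (p⊆q ∘ suc))
... | false | false = count-mono (p⊆q ∘ suc)
... | true  | false with () ← trans (sym (p⊆q zero p₀)) q₀

count-∨ : ∀ (p q : Fin m → Bool) → count (λ i → p i ∨ q i) ≤ count p + count q
count-∨ {zero}  p q = z≤n
count-∨ {suc m} p q with p zero | q zero
... | true  | true  = s≤s (≤-trans (count-∨ (p ∘ suc) (q ∘ suc))
                                   (+-monoʳ-≤ (count (p ∘ suc)) (n≤1+n _)))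
... | true  | false = s≤s (count-∨ (p ∘ suc) (q ∘ suc))
... | false | true  = ≤-trans (s≤s (count-∨ (p ∘ suc) (q ∘ suc))) (≤-reflexive (sym (+-suc _ _)))
... | false | false = count-∨ (p ∘ suc) (q ∘ suc)

count-≤1 : (∀ i j → p i ≡ true → p j ≡ true → i ≡ j) → count p ≤ 1
count-≤1 {zero}      unique = z≤n
count-≤1 {suc m} {p} unique with p zero in p₀
... | true  = s≤s (≤-trans (count-mono {q = λ _ → false} (λ i pᵢ → ⊥-elim (0≢1+n (unique zero (suc i) p₀ pᵢ))))
                           (≤-reflexive (count-false {m})))
... | false = count-≤1 {p = p ∘ suc} λ i j pᵢ pⱼ → suc-injective (unique (suc i) (suc j) pᵢ pⱼ)

count-singleton : (l : Fin m) → count (λ i → does (i ≟ l)) ≤ 1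
count-singleton l = count-≤1 λ i j i≡l j≡l →
  trans (does⇒ (i ≟ l) i≡l) (sym (does⇒ (j ≟ l) j≡l))

count-<-witness : count p < count q → ∃ λ i → q i ≡ true × p i ≡ false
count-<-witness {zero}          ()
count-<-witness {suc m} {p} {q} lt with p zero in p₀ | q zero in q₀
... | false | true  = zero , q₀ , p₀
... | true  | true  = map suc id (count-<-witness (≤-pred lt))
... | true  | false = map suc id (count-<-witness (≤-trans (n≤1+n _) lt))
... | false | false = map suc id (count-<-witness lt)

module _ {m : ℕ} where
  open import Data.List.Membership.DecPropositional (_≟_ {m}) using (_∈?_)

  count-∈ : (L : List (Fin m)) → count (λ i → does (i ∈? L)) ≤ length L
  count-∈ []      = ≤-reflexive (count-false {m})
  count-∈ (l ∷ L) = ≤-trans (count-∨ (λ i → does (i ≟ l)) (λ i → does (i ∈? L)))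
                            (+-mono-≤ (count-singleton l) (count-∈ L))

  count-⊆ : {p : Fin m → Bool} (L : List (Fin m)) → (∀ i → p i ≡ true → i ∈ L) →
            count p ≤ length L
  count-⊆ {p} L p⊆L =
    ≤-trans (count-mono {p = p} λ i pᵢ → dec-true (i ∈? L) (p⊆L i pᵢ)) (count-∈ L)

  count-∉-witness : {p : Fin m → Bool} (L : List (Fin m)) → length L < count p →
                    ∃ λ i → p i ≡ true × i ∉ L
  count-∉-witness L lt =
    map id (map id (does⇒¬ (_ ∈? L))) (count-<-witness (≤-<-trans (count-∈ L) lt))

count-image : (p : Fin m → Bool) (f : Fin m → Fin k) →
              count (λ j → does (any? λ i → T? (p i) ×-dec f i ≟ j)) ≤ count p
count-image {zero}  {k} p f = ≤-reflexive (count-false {k})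
count-image {suc m} {k} p f =
  ≤-trans (count-∨ (λ j → p zero ∧ does (f zero ≟ j)) _)
          (+-mono-≤ hits-of-zero (count-image (p ∘ suc) (f ∘ suc)))
  where
  hits-of-zero : count (λ j → p zero ∧ does (f zero ≟ j)) ≤ (if p zero then 1 else 0)
  hits-of-zero with p zero
  ... | true  = count-≤1 λ i j f₀≡i f₀≡j →
                  trans (sym (does⇒ (f zero ≟ i) f₀≡i)) (does⇒ (f zero ≟ j) f₀≡j)
  ... | false = ≤-reflexive (count-false {k})

count≡sum : (p : Fin m → Bool) → count p ≡ sum (λ i → if p i then 1 else 0)
count≡sum {zero}  p = refl
count≡sum {suc m} p = cong ((if p zero then 1 else 0) +_) (count≡sum (p ∘ suc))

count-transpose : (M : Fin m → Fin k → Bool) →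
                  sum (λ x → count (M x)) ≡ sum (λ y → count (λ x → M x y))
count-transpose M = begin
  sum (λ x → count (M x))                         ≡⟨ sum-cong-≗ (count≡sum ∘ M) ⟩
  sum (λ x → sum (λ y → if M x y then 1 else 0))  ≡⟨ ∑-comm (λ x y → if M x y then 1 else 0) ⟩
  sum (λ y → sum (λ x → if M x y then 1 else 0))  ≡⟨ sum-cong-≗ (count≡sum ∘ λ y x → M x y) ⟨
  sum (λ y → count (λ x → M x y))                 ∎
  where open ≡-Reasoning

sum-mono-≤ : {f g : Fin m → ℕ} → (∀ i → f i ≤ g i) → sum f ≤ sum g
sum-mono-≤ {zero}  f≤g = z≤n
sum-mono-≤ {suc m} f≤g = +-mono-≤ (f≤g zero) (sum-mono-≤ (f≤g ∘ suc))

no-expanding-set : {P : Fin m → Set} (P? : Decidable P) (M : Fin m → Fin m → Bool) →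
                   (∀ x → P x → 2 ≤ count (M x)) →
                   (∀ x y → M x y ≡ true → P y) →
                   (∀ x x′ y → M x y ≡ true → M x′ y ≡ true → x ≡ x′) →
                   ∀ x → ¬ P x
no-expanding-set {m} {P} P? M out≥2 closed in≤1 x Px =
  <-irrefl refl (<-≤-trans (m<m+n (count inP) (count-pos x (dec-true (P? x) Px))) double≤single)
  where
  inP : Fin m → Bool
  inP = does ∘ P?

  [_∈P] : Fin m → ℕ
  [ x ∈P] = if inP x then 1 else 0

  out-bound : ∀ x → [ x ∈P] + [ x ∈P] ≤ count (M x)
  out-bound x with P? x
  ... | yes Px = out≥2 x Px
  ... | no  _  = z≤n

  in-bound : ∀ y → count (λ x → M x y) ≤ [ y ∈P]
  in-bound y with P? y
  ... | yes _  = count-≤1 λ x x′ → in≤1 x x′ y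
  ... | no ¬Py = ≤-trans (count-mono {q = λ _ → false} λ x Mxy → ⊥-elim (¬Py (closed x y Mxy)))
                         (≤-reflexive (count-false {m}))

  double≤single : count inP + count inP ≤ count inP
  double≤single = begin
    count inP + count inP                ≡⟨ cong₂ _+_ (count≡sum inP) (count≡sum inP) ⟩
    sum [_∈P] + sum [_∈P]               ≡⟨ ∑-distrib-+ [_∈P] [_∈P] ⟨
    sum (λ x → [ x ∈P] + [ x ∈P])       ≤⟨ sum-mono-≤ out-bound ⟩
    sum (λ x → count (M x))             ≡⟨ count-transpose M ⟩
    sum (λ y → count (λ x → M x y))     ≤⟨ sum-mono-≤ in-bound ⟩
    sum [_∈P]                           ≡⟨ count≡sum inP ⟨
    count inP                           ∎
    where open ≤-Reasoning

arc-irrefl : (D : Digraph) {x y : V D} → arc D x y ≡ true → x ≢ y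
arc-irrefl D {x} xy refl with () ← trans (sym xy) (loopless D x)

arc-asym : (D : Digraph) {x y : V D} → arc D x y ≡ true → arc D y x ≡ true → ⊥
arc-asym D {x} {y} xy yx with () ← trans (sym yx) (oriented D x y xy)

subOutdeg≤outdeg : ∀ {D} (S : Sub D) x → subOutdeg S x ≤ outdeg D x
subOutdeg≤outdeg S x = count-mono (as⊆ S x)

extend-colouring : ∀ {D} (S : Sub D) (z : V D) → SubColourableMinus S z k →
                   count (λ w → as S w z ∨ as S z w) < k → SubColourable S k
extend-colouring {k} {D} S z (c , proper) deg<k = c′ , proper′
  where
  neighbour : V D → Bool
  neighbour w = as S w z ∨ as S z w

  used : Fin k → Bool
  used j = does (any? λ w → T? (neighbour w) ×-dec c w ≟ j)

  free-colour : ∃ λ j → used j ≡ false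
  free-colour = map id proj₂ (count-<-witness {p = used} {q = λ _ → true}
    (begin-strict
      count used          ≤⟨ count-image neighbour c ⟩
      count neighbour     <⟨ deg<k ⟩
      k                   ≡⟨ count-true {k} ⟨
      count {k} (λ _ → true) ∎))
    where open ≤-Reasoning

  j : Fin k
  j = proj₁ free-colour

  avoids : ∀ w → neighbour w ≡ true → j ≢ c w
  avoids w nw j≡cw =
    does⇒¬ (any? _) (proj₂ free-colour) (w , Equivalence.from T-≡ nw , sym j≡cw)

  c′ : V D → Fin k
  c′ = updateAt c z (const j)

  proper′ : ∀ x y → as S x y ≡ true → c′ x ≢ c′ y
  proper′ x y xy with x ≟ z | y ≟ z
  ... | yes refl | yes refl = ⊥-elim (arc-irrefl D (as⊆ S x x xy) refl)
  ... | yes refl | no y≢z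
    rewrite updateAt-updates z {const j} c | updateAt-minimal y z {const j} c y≢z
    = avoids y (trans (cong (as S y x ∨_) xy) (∨-zeroʳ _))
  ... | no x≢z | yes refl
    rewrite updateAt-updates z {const j} c | updateAt-minimal x z {const j} c x≢z
    = avoids x (cong (_∨ as S y x) xy) ∘ sym
  ... | no x≢z | no y≢z
    rewrite updateAt-minimal x z {const j} c x≢z | updateAt-minimal y z {const j} c y≢z
    = proper x y xy x≢z y≢z

module _ {D : Digraph} (S : Sub D) (critical : Critical5 S) where

  critical-degree : ∀ {z} → vs S z ≡ true → 4 ≤ count (λ w → as S w z ∨ as S z w)
  critical-degree {z} z∈S = ≮⇒≥ λ deg<4 →
    proj₂ (proj₁ critical) 4 (n<1+n 4) (extend-colouring S z (proj₂ critical z z∈S) deg<4)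

  other-in-neighbour : ∀ {z} → vs S z ≡ true → subOutdeg S z ≤ 2 →
                       ∀ b → ∃ λ u → as S u z ≡ true × u ≢ b
  other-in-neighbour {z} z∈S out≤2 b =
    map id (map id (does⇒¬ (_ ≟ b))) (count-<-witness (≤-trans (s≤s (count-singleton b)) two-in))
    where
    in-degree : ℕ
    in-degree = count (λ u → as S u z)

    two-in : 2 ≤ in-degree
    two-in = +-cancelʳ-≤ 2 2 in-degree (begin
      4                                         ≤⟨ critical-degree z∈S ⟩
      count (λ w → as S w z ∨ as S z w)         ≤⟨ count-∨ (λ w → as S w z) (as S z) ⟩
      in-degree + subOutdeg S z                 ≤⟨ +-monoʳ-≤ in-degree out≤2 ⟩
      in-degree + 2                             ∎)
      where open ≤-Reasoning

module P4-free {D : Digraph} (out≥2 : ∀ x → 2 ≤ outdeg D x) (p4-free : ¬ HasP4 D) where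

  p4-merge : ∀ {x y z v w} →
             arc D y x ≡ true → arc D y z ≡ true → arc D v z ≡ true → arc D v w ≡ true →
             x ≢ z → w ≢ z → x ≢ v → w ≢ y → v ≢ y → x ≡ w
  p4-merge {x} {y} {z} {v} {w} yx yz vz vw x≢z w≢z x≢v w≢y v≢y with x ≟ w
  ... | yes x≡w = x≡w
  ... | no  x≢w = ⊥-elim (p4-free (f , injective , yx , yz , vz , vw))
    where
    f : Fin 5 → V D
    f 0F = x
    f 1F = y
    f 2F = z
    f 3F = v
    f 4F = w

    position : V D → Fin 5
    position u = if does (u ≟ x) then 0F else if does (u ≟ y) then 1F
                 else if does (u ≟ z) then 2F else if does (u ≟ v) then 3F else 4F

    position-f : ∀ i → position (f i) ≡ i
    position-f 0F rewrite dec-true (x ≟ x) refl = refl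
    position-f 1F rewrite dec-false (y ≟ x) (arc-irrefl D yx) | dec-true (y ≟ y) refl = refl
    position-f 2F rewrite dec-false (z ≟ x) (x≢z ∘ sym) | dec-false (z ≟ y) (arc-irrefl D yz ∘ sym)
                        | dec-true (z ≟ z) refl = refl
    position-f 3F rewrite dec-false (v ≟ x) (x≢v ∘ sym) | dec-false (v ≟ y) v≢y
                        | dec-false (v ≟ z) (arc-irrefl D vz) | dec-true (v ≟ v) refl = refl
    position-f 4F rewrite dec-false (w ≟ x) (x≢w ∘ sym) | dec-false (w ≟ y) w≢y
                        | dec-false (w ≟ z) w≢z | dec-false (w ≟ v) (arc-irrefl D vw ∘ sym) = refl

    injective : Injective _≡_ _≡_ f
    injective {i} {j} fi≡fj =
      trans (sym (position-f i)) (trans (cong position fi≡fj) (position-f j))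

  Heavy : V D → Set
  Heavy x = 3 ≤ outdeg D x

  _⁺⊆_ : V D → List (V D) → Set
  x ⁺⊆ L = ∀ w → arc D x w ≡ true → w ∈ L

  out-neighbour-∉ : ∀ {x} (L : List (V D)) → length L < outdeg D x →
                    ∃ λ w → arc D x w ≡ true × w ∉ L
  out-neighbour-∉ = count-∉-witness

  shared-out-neighbour-forward : ∀ {y z v} → Heavy y →
    arc D y z ≡ true → arc D v z ≡ true → arc D y v ≡ true →
    ∃ λ x → arc D y x ≡ true × arc D v x ≡ true × v ⁺⊆ (z ∷ x ∷ []) × y ⁺⊆ (z ∷ v ∷ x ∷ [])
  shared-out-neighbour-forward {y} {z} {v} heavy yz vz yv
    with out-neighbour-∉ (z ∷ []) (out≥2 v) | out-neighbour-∉ (z ∷ v ∷ []) heavy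
  ... | w , vw , w∉ | x₀ , yx₀ , x₀∉ =
    w , subst (λ t → arc D y t ≡ true) x₀≡w yx₀ , vw , v⁺⊆ , y⁺⊆
    where
    merge : ∀ {x u} → arc D y x ≡ true → arc D v u ≡ true → x ≢ z → u ≢ z → x ≢ v → x ≡ u
    merge yx vu x≢z u≢z x≢v =
      p4-merge yx yz vz vu x≢z u≢z x≢v (λ { refl → arc-asym D yv vu }) (arc-irrefl D yv ∘ sym)

    x₀≡w : x₀ ≡ w
    x₀≡w = merge yx₀ vw (x₀∉ ∘ here) (w∉ ∘ here) (x₀∉ ∘ there ∘ here)

    v⁺⊆ : v ⁺⊆ (z ∷ w ∷ [])
    v⁺⊆ u vu with u ≟ z
    ... | yes u≡z = here u≡z
    ... | no  u≢z =
      there (here (trans (sym (merge yx₀ vu (x₀∉ ∘ here) u≢z (x₀∉ ∘ there ∘ here))) x₀≡w))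

    y⁺⊆ : y ⁺⊆ (z ∷ v ∷ w ∷ [])
    y⁺⊆ x yx with x ≟ z | x ≟ v
    ... | yes x≡z | _        = here x≡z
    ... | no  _   | yes x≡v  = there (here x≡v)
    ... | no  x≢z | no  x≢v  = there (there (here (merge yx vw x≢z (w∉ ∘ here) x≢v)))

  shared-out-neighbour-backward : ∀ {y z v} → Heavy y → arc D y z ≡ true → arc D v z ≡ true →
    arc D y v ≡ false → v ≢ y → arc D v y ≡ true × v ⁺⊆ (z ∷ y ∷ [])
  shared-out-neighbour-backward {y} {z} {v} heavy yz vz y↛v v≢y = vy , v⁺⊆
    where
    v⁺⊆ : v ⁺⊆ (z ∷ y ∷ [])
    v⁺⊆ w vw with w ≟ z | w ≟ y | out-neighbour-∉ (z ∷ w ∷ []) heavy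
    ... | yes w≡z | _       | _            = here w≡z
    ... | no  _   | yes w≡y | _            = there (here w≡y)
    ... | no  w≢z | no  w≢y | x , yx , x∉ =
      ⊥-elim (x∉ (there (here (p4-merge yx yz vz vw (x∉ ∘ here) w≢z x≢v w≢y v≢y))))
      where
      x≢v : x ≢ v
      x≢v refl with () ← trans (sym yx) y↛v

    vy : arc D v y ≡ true
    vy with out-neighbour-∉ (z ∷ []) (out≥2 v)
    ... | w , vw , w∉ with v⁺⊆ w vw
    ...   | here w≡z          = ⊥-elim (w∉ (here w≡z))
    ...   | there (here refl) = vw

  ⁺⊆-outdeg : ∀ {x} (L : List (V D)) → x ⁺⊆ L → outdeg D x ≤ length L
  ⁺⊆-outdeg = count-⊆

  ⁺⊆-pair⇒¬heavy : ∀ {x a b} → x ⁺⊆ (a ∷ b ∷ []) → ¬ Heavy x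
  ⁺⊆-pair⇒¬heavy x⁺⊆ heavy = <-irrefl refl (≤-trans heavy (⁺⊆-outdeg _ x⁺⊆))

  heavy-arc-no-shared-out-neighbour : ∀ {a b z} → arc D a b ≡ true → Heavy a → Heavy b →
                                      arc D a z ≡ true → arc D b z ≡ true → ⊥
  heavy-arc-no-shared-out-neighbour ab ha hb az bz = ⁺⊆-pair⇒¬heavy
    (proj₂ (shared-out-neighbour-backward hb bz az (oriented D _ _ ab) (arc-irrefl D ab))) ha

  heavy-arc-no-common-in-neighbour : ∀ {a b z u} → arc D a b ≡ true → Heavy a → Heavy b →
                                     arc D b z ≡ true → arc D u b ≡ true → arc D u z ≡ true → ⊥
  heavy-arc-no-common-in-neighbour {a} {b} {z} {u} ab ha hb bz ub uz with u ≟ a | arc D a u in au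
  ... | yes refl | _     = heavy-arc-no-shared-out-neighbour ab ha hb uz bz
  ... | no  u≢a  | true  with shared-out-neighbour-forward ha ab ub au
  ...   | x , ax , _ , u⁺⊆ , _ with u⁺⊆ z uz
  ...     | here refl         = arc-irrefl D bz refl
  ...     | there (here refl) = heavy-arc-no-shared-out-neighbour ab ha hb ax bz
  heavy-arc-no-common-in-neighbour {a} {b} {z} {u} ab ha hb bz ub uz | no u≢a | false
    with proj₂ (shared-out-neighbour-backward ha ab ub au u≢a) z uz
  ... | here refl         = arc-irrefl D bz refl
  ... | there (here refl) = arc-asym D ab bz

  heavy-arc-rival-is-out-neighbour : ∀ {a b z u} → arc D a b ≡ true → Heavy a → Heavy b →
                                     arc D b z ≡ true → arc D u z ≡ true → u ≢ b → arc D b u ≡ true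
  heavy-arc-rival-is-out-neighbour {a} {b} {z} {u} ab ha hb bz uz u≢b with arc D b u in bu
  ... | true  = refl
  ... | false = ⊥-elim (heavy-arc-no-common-in-neighbour ab ha hb bz
                          (proj₁ (shared-out-neighbour-backward hb bz uz bu u≢b)) uz)

  module _ (S : Sub D) (critical : Critical5 S) where

    heavy-arc-unique-in-neighbour : ∀ {a b z u} → arc D a b ≡ true → Heavy a → Heavy b →
                                    arc D b z ≡ true → as S u z ≡ true → u ≡ b
    heavy-arc-unique-in-neighbour {a} {b} {z} {u} ab ha hb bz uz with u ≟ b
    ... | yes u≡b = u≡b
    ... | no  u≢b with heavy-arc-rival-is-out-neighbour ab ha hb bz (as⊆ S u z uz) u≢b
    ...   | bu with shared-out-neighbour-forward hb bz (as⊆ S u z uz) bu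
    ...     | p , _ , up , u⁺⊆ , b⁺⊆ with other-in-neighbour S critical (proj₁ (as-vs S u z uz))
                                            (≤-trans (subOutdeg≤outdeg S u) (⁺⊆-outdeg _ u⁺⊆)) b
    ...       | u′ , u′u , u′≢b
      with b⁺⊆ u′ (heavy-arc-rival-is-out-neighbour ab ha hb bu (as⊆ S u′ u u′u) u′≢b)
    ...         | here refl                 = ⊥-elim (arc-asym D (as⊆ S u z uz) (as⊆ S u′ u u′u))
    ...         | there (here refl)         = ⊥-elim (arc-irrefl D (as⊆ S u′ u u′u) refl)
    ...         | there (there (here refl)) = ⊥-elim (arc-asym D up (as⊆ S u′ u u′u))

    Good : V D → Set
    Good z = vs S z ≡ true × 3 ≤ subOutdeg S z × ∃ λ a → arc D a z ≡ true × Heavy a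

    good? : Decidable Good
    good? z = vs S z Bool.≟ true ×-dec 3 ≤? subOutdeg S z
              ×-dec any? (λ a → arc D a z Bool.≟ true ×-dec 3 ≤? outdeg D a)

    good⇒heavy : ∀ {b} → Good b → Heavy b
    good⇒heavy {b} (_ , out3 , _) = ≤-trans out3 (subOutdeg≤outdeg S b)

    Dᵒ-arc⇒good : ∀ {x y} → InDo S x → InDo S y → arc D x y ≡ true → Good y
    Dᵒ-arc⇒good {x} (_ , x-out3) (y∈S , y-out3) xy =
      y∈S , y-out3 , x , xy , ≤-trans x-out3 (subOutdeg≤outdeg S x)

    good-unique-in-neighbour : ∀ {b z u} → Good b → as S b z ≡ true → as S u z ≡ true → u ≡ b
    good-unique-in-neighbour {b} {z} gb@(_ , _ , a , ab , ha) bz =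
      heavy-arc-unique-in-neighbour ab ha (good⇒heavy gb) (as⊆ S b z bz)

    good-successor : ∀ {b z} → Good b → as S b z ≡ true → Good z
    good-successor {b} {z} gb bz = z∈S , out3 , b , as⊆ S b z bz , good⇒heavy gb
      where
      z∈S : vs S z ≡ true
      z∈S = proj₂ (as-vs S b z bz)

      out3 : 3 ≤ subOutdeg S z
      out3 = ≮⇒≥ λ out<3 → let u , uz , u≢b = other-in-neighbour S critical z∈S (≤-pred out<3) b
                           in u≢b (good-unique-in-neighbour gb bz uz)

    good-arc : V D → V D → Bool
    good-arc x y = does (good? x) ∧ as S x y

    good-arc⇒ : ∀ {x y} → good-arc x y ≡ true → Good x × as S x y ≡ true
    good-arc⇒ {x} gxy = let gx , xy = ∧-true (does (good? x)) gxy in does⇒ (good? x) gx , xy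

    no-good : ∀ z → ¬ Good z
    no-good = no-expanding-set good? good-arc out≥2′ closed in≤1
      where
      out≥2′ : ∀ x → Good x → 2 ≤ count (good-arc x)
      out≥2′ x gx rewrite dec-true (good? x) gx = ≤-trans (n≤1+n 2) (proj₁ (proj₂ gx))

      closed : ∀ x y → good-arc x y ≡ true → Good y
      closed x y gxy = let gx , xy = good-arc⇒ gxy in good-successor gx xy

      in≤1 : ∀ x x′ y → good-arc x y ≡ true → good-arc x′ y ≡ true → x ≡ x′
      in≤1 x x′ y gxy gx′y = let gx , xy = good-arc⇒ gxy in
        sym (good-unique-in-neighbour gx xy (proj₂ (good-arc⇒ gx′y)))

    Dᵒ-independent : Independent D (InDo S)
    Dᵒ-independent x y x∈Dᵒ y∈Dᵒ adj with arc D x y in xy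
    ... | true  = no-good y (Dᵒ-arc⇒good x∈Dᵒ y∈Dᵒ xy)
    ... | false = no-good x (Dᵒ-arc⇒good y∈Dᵒ x∈Dᵒ adj)

lemma2p12 : (D : Digraph) → Connected D → ChromaticNumber D 5 → ¬ Iso D T5 →
    (∀ x → 2 ≤ outdeg D x) → ¬ HasP4 D → ¬ HasK5 D →
    (D' : Sub D) → Critical5 D' → Independent D (InDo D')
lemma2p12 D _ _ _ out≥2 p4-free _ = P4-free.Dᵒ-independent out≥2 p4-free
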